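{- Let $G$ be a graph such that every 2-connected subgraph $B$ of $G$ contains at least two vertices of degree at most $2$ in $B$. Then every subgraph $H$ of $G$ with at least two vertices contains at least two vertices of degree at most $2$ in $H$.
   Context: All graphs are finite, simple and undirected. A graph is 2-connected if it has at least two vertices, is connected, and has no cut vertex (so a single edge is 2-connected). -}

module Defs where

open import Data.Nat using (ℕ; zero; suc; _≤_; _+_)
open import Data.Fin using (Fin; _≟_)
open import Data.Bool using (Bool; true; false; _∧_; not; if_then_else_)
open import Data.List using (List; map; allFin)
open import Data.Nat.ListAction using (sum)
open import Data.Product using (Σ; _×_; _,_; ∃; ∃-syntax)
open import Relation.Nullary using (¬_)
open import Relation.Nullary.Decidable using (⌊_⌋)
open import Relation.Binary.PropositionalEquality using (_≡_)

record Graph (n : ℕ) : Set where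
  field
    Adj    : Fin n → Fin n → Bool
    sym    : ∀ u v → Adj u v ≡ Adj v u
    irrefl : ∀ v → Adj v v ≡ false
open Graph public

record Subgraph {n : ℕ} (G : Graph n) : Set where
  field
    V      : Fin n → Bool
    E      : Fin n → Fin n → Bool
    E-sym  : ∀ u v → E u v ≡ E v u
    E⊆Adj  : ∀ u v → E u v ≡ true → Adj G u v ≡ true
    E-endˡ : ∀ u v → E u v ≡ true → V u ≡ true
    E-endʳ : ∀ u v → E u v ≡ true → V v ≡ true
open Subgraph public

degree : {n : ℕ} {G : Graph n} → Subgraph G → Fin n → ℕ
degree {n} H v = sum (map (λ u → if E H v u then 1 else 0) (allFin n))

data Reach {n : ℕ} (E : Fin n → Fin n → Bool) : Fin n → Fin n → Set where
  here  : ∀ {u} → Reach E u u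
  there : ∀ {u w v} → E u w ≡ true → Reach E w v → Reach E u v

Connected : {n : ℕ} → (Fin n → Bool) → (Fin n → Fin n → Bool) → Set
Connected V E = ∀ u v → V u ≡ true → V v ≡ true → Reach E u v

AtLeastTwoVertices : {n : ℕ} {G : Graph n} → Subgraph G → Set
AtLeastTwoVertices H = ∃[ u ] ∃[ v ] (¬ u ≡ v × V H u ≡ true × V H v ≡ true)

delV : {n : ℕ} → (Fin n → Bool) → Fin n → (Fin n → Bool)
delV V w u = V u ∧ not ⌊ u ≟ w ⌋

delE : {n : ℕ} → (Fin n → Fin n → Bool) → Fin n → (Fin n → Fin n → Bool)
delE E w u v = E u v ∧ (not ⌊ u ≟ w ⌋ ∧ not ⌊ v ≟ w ⌋)

IsCutVertex : {n : ℕ} {G : Graph n} → Subgraph G → Fin n → Set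
IsCutVertex H w = V H w ≡ true × ¬ Connected (delV (V H) w) (delE (E H) w)

TwoConnected : {n : ℕ} {G : Graph n} → Subgraph G → Set
TwoConnected H = AtLeastTwoVertices H × Connected (V H) (E H) × (∀ w → ¬ IsCutVertex H w)

TwoLowDegree : {n : ℕ} {G : Graph n} → Subgraph G → Set
TwoLowDegree H = ∃[ u ] ∃[ v ] (¬ u ≡ v × V H u ≡ true × V H v ≡ true
                                × degree H u ≤ 2 × degree H v ≤ 2)

-- Induction on the number of vertices of H. If H is 2-connected the hypothesis applies.
-- Otherwise deleting a set K of at most one vertex (K empty if H is disconnected, K a cut
-- vertex otherwise) disconnects H; split H − K into the component C of some vertex x and
-- the rest D ∋ y. In H[C ∪ K] a vertex of C has the same neighbours as in H. If x has no
-- neighbour it is isolated in H; otherwise H[C ∪ K] has two vertices and misses y, so by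
-- induction it has two vertices of degree ≤ 2, one of which avoids K and so lies in C.
-- The same for D gives a second such vertex of H.
--
-- Reachability is never decided: the argument runs in the double-negation monad, which
-- is enough because the conclusion is decidable.
module Submission where

open import Defs hiding (sym)
open import Data.Bool using (Bool; true; false; _∧_; _∨_; not; if_then_else_)
open import Data.Bool.Properties
  using (∧-comm; ∧-conicalˡ; ∧-conicalʳ; ¬-not; not-injective) renaming (_≟_ to _≟ᵇ_)
open import Data.Fin using (Fin; zero; suc; _≟_)
open import Data.Fin.Properties using (any?)
open import Data.Fin.Subset using (_∈_; ∣_∣)
open import Data.Fin.Subset.Properties using (p⊂q⇒∣p∣<∣q∣)
open import Data.List using (List; []; _∷_; map; allFin)
open import Data.List.Properties using (map-cong)
open import Data.Nat using (ℕ; zero; suc; _≤_; _<_; z≤n; _≤?_)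
open import Data.Nat.ListAction using (sum)
open import Data.Nat.Properties using (≤-refl; ≤-pred; <-≤-trans)
open import Data.Product using (_×_; _,_; ∃-syntax; proj₁; proj₂)
open import Data.Sum using (_⊎_; inj₁; inj₂; [_,_]′)
open import Data.Vec using (tabulate)
open import Data.Vec.Properties using (lookup∘tabulate; lookup⇒[]=; []=⇒lookup)
open import Function using (_∘_; mk⇔)
open import Effect.Monad using (RawMonad)
open import Level using (0ℓ)
open import Relation.Nullary using (¬_; Dec; yes; no; does; ¬?; _×-dec_; contradiction)
open import Relation.Nullary.Decidable
  using (⌊_⌋; ¬¬-excluded-middle; decidable-stable; dec-true; dec-false; does-⇔)
open import Relation.Nullary.Negation using (¬¬-Monad)
open import Relation.Binary.PropositionalEquality using (_≡_; refl; sym; trans; cong; cong₂; subst)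

open RawMonad (¬¬-Monad {0ℓ})

∧-true : ∀ {a b} → a ≡ true → b ≡ true → a ∧ b ≡ true
∧-true refl refl = refl

¬¬-Π-Fin : ∀ {n} {P : Fin n → Set} → (∀ i → ¬ ¬ P i) → ¬ ¬ (∀ i → P i)
¬¬-Π-Fin {zero}  _ = pure λ ()
¬¬-Π-Fin {suc n} f = do
  p₀ ← f zero
  ps ← ¬¬-Π-Fin (f ∘ suc)
  pure λ { zero → p₀ ; (suc i) → ps i }

¬∀⇒¬¬∃¬-Fin : ∀ {n} {P : Fin n → Set} → ¬ (∀ i → P i) → ¬ ¬ (∃[ i ] ¬ P i)
¬∀⇒¬¬∃¬-Fin ¬∀ ¬∃ = ¬¬-Π-Fin (λ i ¬Pi → ¬∃ (i , ¬Pi)) ¬∀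

module _ {n : ℕ} where

  ∈-tabulate⁺ : ∀ {S : Fin n → Bool} {x} → S x ≡ true → x ∈ tabulate S
  ∈-tabulate⁺ {S} {x} Sx = lookup⇒[]= x (tabulate S) (trans (lookup∘tabulate S x) Sx)

  ∈-tabulate⁻ : ∀ {S : Fin n → Bool} {x} → x ∈ tabulate S → S x ≡ true
  ∈-tabulate⁻ {S} {x} x∈S = trans (sym (lookup∘tabulate S x)) ([]=⇒lookup x∈S)

  AtMostOne : (Fin n → Bool) → Set
  AtMostOne K = ∀ {a b} → K a ≡ true → K b ≡ true → a ≡ b

  AtMostOne-avoids : ∀ {K a b} → AtMostOne K → ¬ a ≡ b → K a ≡ false ⊎ K b ≡ false
  AtMostOne-avoids {K} {a} {b} K≤1 a≢b with K a in Ka | K b in Kb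
  ... | false | _     = inj₁ refl
  ... | true  | false = inj₂ refl
  ... | true  | true  = contradiction (K≤1 Ka Kb) a≢b

  AtMostOne-≟ : (w : Fin n) → AtMostOne (λ z → ⌊ z ≟ w ⌋)
  AtMostOne-≟ w {a} {b} a≡w b≡w = trans (witness a a≡w) (sym (witness b b≡w))
    where
    witness : ∀ z → ⌊ z ≟ w ⌋ ≡ true → z ≡ w
    witness z eq with z ≟ w
    ... | yes z≡w = z≡w

  Reach-mono : ∀ {E₁ E₂ : Fin n → Fin n → Bool} → (∀ a b → E₁ a b ≡ true → E₂ a b ≡ true)
    → ∀ {u v} → Reach E₁ u v → Reach E₂ u v
  Reach-mono E₁⊆E₂ here        = here
  Reach-mono E₁⊆E₂ (there e r) = there (E₁⊆E₂ _ _ e) (Reach-mono E₁⊆E₂ r)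

  Reach-snoc : ∀ {E : Fin n → Fin n → Bool} {u v w} → Reach E u v → E v w ≡ true → Reach E u w
  Reach-snoc here        e = there e here
  Reach-snoc (there e′ r) e = there e′ (Reach-snoc r e)

  ¬Connected⇒separated : ∀ {V : Fin n → Bool} {E : Fin n → Fin n → Bool} → ¬ Connected V E
    → ¬ ¬ (∃[ x ] ∃[ y ] (V x ≡ true × V y ≡ true × ¬ Reach E x y))
  ¬Connected⇒separated {V} {E} disc = do
    x , ¬∀y ← ¬∀⇒¬¬∃¬-Fin disc
    y , ¬xy ← ¬∀⇒¬¬∃¬-Fin ¬∀y
    Vx ← (λ ¬Vx → ¬xy λ Vx → contradiction Vx ¬Vx)
    Vy ← (λ ¬Vy → ¬xy λ _ Vy → contradiction Vy ¬Vy)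
    pure (x , y , Vx , Vy , λ r → ¬xy λ _ _ → r)

module _ {n : ℕ} {G : Graph n} where

  order : Subgraph G → ℕ
  order H = ∣ tabulate (V H) ∣

  IsConnected : Subgraph G → Set
  IsConnected H = Connected (V H) (E H)

  E-irrefl : (H : Subgraph G) → ∀ {u v} → E H u v ≡ true → ¬ u ≡ v
  E-irrefl H {u} e refl = contradiction (trans (sym (E⊆Adj H u u e)) (irrefl G u)) λ ()

  restrict : Subgraph G → (Fin n → Bool) → Subgraph G
  restrict H S = record
    { V      = λ z → V H z ∧ S z
    ; E      = λ a b → E H a b ∧ (S a ∧ S b)
    ; E-sym  = λ a b → cong₂ _∧_ (E-sym H a b) (∧-comm (S a) (S b))
    ; E⊆Adj  = λ a b e → E⊆Adj H a b (edge e)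
    ; E-endˡ = λ a b e → ∧-true (E-endˡ H a b (edge e)) (∧-conicalˡ (S a) (S b) (ends e))
    ; E-endʳ = λ a b e → ∧-true (E-endʳ H a b (edge e)) (∧-conicalʳ (S a) (S b) (ends e))
    }
    where
    edge : ∀ {a b} → E H a b ∧ (S a ∧ S b) ≡ true → E H a b ≡ true
    edge {a} {b} = ∧-conicalˡ (E H a b) (S a ∧ S b)
    ends : ∀ {a b} → E H a b ∧ (S a ∧ S b) ≡ true → S a ∧ S b ≡ true
    ends {a} {b} = ∧-conicalʳ (E H a b) (S a ∧ S b)

  _─_ : Subgraph G → (Fin n → Bool) → Subgraph G
  H ─ K = restrict H (not ∘ K)

  order-restrict-< : (H : Subgraph G) (S : Fin n → Bool) {y : Fin n}
    → V H y ≡ true → S y ≡ false → order (restrict H S) < order H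
  order-restrict-< H S {y} Vy Sy = p⊂q⇒∣p∣<∣q∣ (⊆ , y , ∈-tabulate⁺ Vy , y∉)
    where
    ⊆ : ∀ {z} → z ∈ tabulate (V (restrict H S)) → z ∈ tabulate (V H)
    ⊆ z∈ = ∈-tabulate⁺ (∧-conicalˡ _ _ (∈-tabulate⁻ z∈))
    y∉ : ¬ y ∈ tabulate (V (restrict H S))
    y∉ y∈ = contradiction (trans (sym (∧-conicalʳ _ _ (∈-tabulate⁻ y∈))) Sy) λ ()

  degree-restrict : (H : Subgraph G) (S : Fin n → Bool) {z : Fin n} → S z ≡ true
    → (∀ {u} → E H z u ≡ true → S u ≡ true) → degree (restrict H S) z ≡ degree H z
  degree-restrict H S {z} Sz nbrs = cong sum (map-cong indicator (allFin n))
    where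
    indicator : ∀ u → (if E H z u ∧ (S z ∧ S u) then 1 else 0) ≡ (if E H z u then 1 else 0)
    indicator u with E H z u in e
    ... | false = refl
    ... | true rewrite Sz | nbrs e = refl

  degree-isolated : (H : Subgraph G) {z : Fin n} → (∀ u → E H z u ≡ false) → degree H z ≡ 0
  degree-isolated H {z} none = sum-zeros (allFin n)
    where
    sum-zeros : (us : List (Fin n)) → sum (map (λ u → if E H z u then 1 else 0) us) ≡ 0
    sum-zeros [] = refl
    sum-zeros (u ∷ us) rewrite none u = sum-zeros us

  component-closed : (H : Subgraph G) {x : Fin n} (reach? : ∀ z → Dec (Reach (E H) x z))
    → ∀ {a b} → E H a b ≡ true → does (reach? a) ≡ does (reach? b)
  component-closed H reach? {a} {b} e =
    does-⇔ (mk⇔ (λ r → Reach-snoc r e) (λ r → Reach-snoc r (trans (E-sym H b a) e)))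
           (reach? a) (reach? b)

  IsConnected-─∅ : (H : Subgraph G) → IsConnected (H ─ λ _ → false) → IsConnected H
  IsConnected-─∅ H conn u v Vu Vv =
    Reach-mono (λ a b → ∧-conicalˡ (E H a b) true) (conn u v (∧-true Vu refl) (∧-true Vv refl))

  ∈-─⁻ : (H : Subgraph G) (K : Fin n → Bool) {z : Fin n}
    → V (H ─ K) z ≡ true → V H z ≡ true × K z ≡ false
  ∈-─⁻ H K {z} z∈ =
    ∧-conicalˡ (V H z) (not (K z)) z∈ , not-injective (∧-conicalʳ (V H z) (not (K z)) z∈)

  LowDegreeBelow : Subgraph G → Set
  LowDegreeBelow H = (H′ : Subgraph G) → order H′ < order H
    → AtLeastTwoVertices H′ → ¬ ¬ TwoLowDegree H′

  low-degree-on-side : (H : Subgraph G) → LowDegreeBelow H → (K : Fin n → Bool) → AtMostOne K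
    → (C : Fin n → Bool) → (∀ {a b} → E (H ─ K) a b ≡ true → C a ≡ C b)
    → ∀ {x y} → V (H ─ K) x ≡ true → C x ≡ true → V (H ─ K) y ≡ true → C y ≡ false
    → ¬ ¬ (∃[ z ] (V H z ≡ true × C z ≡ true × degree H z ≤ 2))
  low-degree-on-side H ih K K≤1 C C-closed {x} {y} x∈ Cx y∈ Cy with any? (λ u → E H x u ≟ᵇ true)
  ... | no isolated =
    pure (x , proj₁ (∈-─⁻ H K x∈) , Cx , subst (_≤ 2) (sym (degree-isolated H no-edge)) z≤n)
    where
    no-edge : ∀ u → E H x u ≡ false
    no-edge u = ¬-not λ e → isolated (u , e)
  ... | yes (u , xu) = do
    a , b , a≢b , a∈P , b∈P , da , db ←
      ih P (order-restrict-< H S Vy Sy) (x , u , E-irrefl H xu , x∈P , u∈P)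
    pure ([ found a∈P da , found b∈P db ]′ (AtMostOne-avoids K≤1 a≢b))
    where
    S : Fin n → Bool
    S z = K z ∨ C z
    P : Subgraph G
    P = restrict H S
    Vx : V H x ≡ true
    Vx = proj₁ (∈-─⁻ H K x∈)
    Kx : K x ≡ false
    Kx = proj₂ (∈-─⁻ H K x∈)
    Vy : V H y ≡ true
    Vy = proj₁ (∈-─⁻ H K y∈)
    Sy : S y ≡ false
    Sy = trans (cong (_∨ C y) (proj₂ (∈-─⁻ H K y∈))) Cy
    E-─⁺ : ∀ {a b} → E H a b ≡ true → K a ≡ false → K b ≡ false → E (H ─ K) a b ≡ true
    E-─⁺ e Ka Kb rewrite e | Ka | Kb = refl
    S-closed : ∀ {z u} → K z ≡ false → C z ≡ true → E H z u ≡ true → S u ≡ true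
    S-closed {z} {u} Kz Cz e with K u in Ku
    ... | true  = refl
    ... | false = trans (sym (C-closed (E-─⁺ e Kz Ku))) Cz
    x∈P : V P x ≡ true
    x∈P = ∧-true Vx (trans (cong (_∨ C x) Kx) Cx)
    u∈P : V P u ≡ true
    u∈P = ∧-true (E-endʳ H x u xu) (S-closed Kx Cx xu)
    found : ∀ {z} → V P z ≡ true → degree P z ≤ 2 → K z ≡ false
      → ∃[ z ] (V H z ≡ true × C z ≡ true × degree H z ≤ 2)
    found {z} z∈P dz Kz = z , ∧-conicalˡ (V H z) (S z) z∈P , Cz
                        , subst (_≤ 2) (degree-restrict H S Sz (S-closed Kz Cz)) dz
      where
      Sz : S z ≡ true
      Sz = ∧-conicalʳ (V H z) (S z) z∈P
      Cz : C z ≡ true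
      Cz = trans (sym (cong (_∨ C z) Kz)) Sz

  low-degree-if-separable : (H : Subgraph G) → LowDegreeBelow H → (K : Fin n → Bool) → AtMostOne K
    → ¬ IsConnected (H ─ K) → ¬ ¬ TwoLowDegree H
  low-degree-if-separable H ih K K≤1 disc = do
    x , y , x∈ , y∈ , ¬x⇝y ← ¬Connected⇒separated disc
    reach? ← ¬¬-Π-Fin (λ z → ¬¬-excluded-middle {A = Reach (E (H ─ K)) x z})
    let C = λ z → does (reach? z)
        C-closed = component-closed (H ─ K) reach?
        Cx = dec-true (reach? x) here
        Cy = dec-false (reach? y) ¬x⇝y
    z₁ , V₁ , C₁ , d₁ ← low-degree-on-side H ih K K≤1 C C-closed x∈ Cx y∈ Cy
    z₂ , V₂ , C₂ , d₂ ← low-degree-on-side H ih K K≤1 (not ∘ C) (cong not ∘ C-closed)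
                          y∈ (cong not Cy) x∈ (cong not Cx)
    pure (z₁ , z₂ , (λ { refl → contradiction (trans (sym C₂) (cong not C₁)) λ () })
         , V₁ , V₂ , d₁ , d₂)

  TwoLowDegree? : (H : Subgraph G) → Dec (TwoLowDegree H)
  TwoLowDegree? H = any? λ u → any? λ v →
    ¬? (u ≟ v) ×-dec (V H u ≟ᵇ true) ×-dec (V H v ≟ᵇ true)
               ×-dec (degree H u ≤? 2) ×-dec (degree H v ≤? 2)

module _ {n : ℕ} {G : Graph n} (hyp : (B : Subgraph G) → TwoConnected B → TwoLowDegree B) where

  low-degree-step : (H : Subgraph G) → LowDegreeBelow H → AtLeastTwoVertices H → ¬ ¬ TwoLowDegree H
  low-degree-step H ih two = do
    yes conn ← ¬¬-excluded-middle
      where no disc → low-degree-if-separable H ih (λ _ → false) (λ ()) (disc ∘ IsConnected-─∅ H)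
    yes (w , _ , cut) ← ¬¬-excluded-middle {A = ∃[ w ] IsCutVertex H w}
      where no no-cut → pure (hyp H (two , conn , λ w c → no-cut (w , c)))
    low-degree-if-separable H ih (λ z → ⌊ z ≟ w ⌋) (AtMostOne-≟ w) cut

  low-degree : ∀ k (H : Subgraph G) → order H < k → AtLeastTwoVertices H → ¬ ¬ TwoLowDegree H
  low-degree zero    H ()
  low-degree (suc k) H bound =
    low-degree-step H λ H′ H′<H → low-degree k H′ (<-≤-trans H′<H (≤-pred bound))

proposition5 : (n : ℕ) (G : Graph n)
    → ((B : Subgraph G) → TwoConnected B → TwoLowDegree B)
    → (H : Subgraph G) → AtLeastTwoVertices H → TwoLowDegree H
proposition5 n G hyp H two =
  decidable-stable (TwoLowDegree? H) (low-degree hyp (suc (order H)) H ≤-refl two)
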